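{- Let $n\in\omega$ and let $(\leq_i)_{i\le n}$ be a sequence of binary relations on $\omega$ satisfying (B0) $\leq_0$ is the usual order on $\omega$; (B1) the relations are uniformly computable; (B2) each $\leq_i$ is reflexive and transitive; (B3) if $j\le i\le n$ and $s\leq_i t$ then $s\leq_j t$; and ($\clubsuit$) for every $i<n$ and all $r<s<t$, if $r\leq_{i+1}t$ and $s\leq_i t$ then $r\leq_{i+1}s$. Let $(L,P_0,(\leq^L_i)_{i\le n})$ be an $n$-system satisfying the extendibility condition. Then there exists an infinite computable $0$-run $\pi$ for this $n$-system. Moreover, such a $0$-run can be built uniformly in (indices for) the $n$-system.
   Context: An $n$-system is a triple $(L,P_0,(\leq^L_i)_{i\le n})$ where $L\subseteq\omega$ is a computable set (of "states"), $P_0$ is a computable subtree of $L^{<\omega}$ (the "action tree"), and $(\leq^L_i)_{i\le n}$ is a uniformly computable sequence of reflexive transitive relations on $L$ which is nested (if $j\le i$ and $\ell\leq^L_i\ell'$ then $\ell\leq^L_j\ell'$). A $0$-run is a finite or infinite sequence $\pi=(\ell_0,\ell_1,\dots)$ which is either in $P_0$ or is an infinite path through $P_0$, such that for all $s,t<|\pi|$ and all $i\le n$: $s\leq_i t\Rightarrow \ell_s\leq^L_i\ell_t$. The extendibility condition: whenever $p=\langle\ell_0,\dots,\ell_{s-1}\rangle$ is a finite $0$-run (possibly empty) and $s_k\le s_{k-1}\le\dots\le s_0<s$ is a (possibly empty) finite list of stages with $k\le n$ such that $\ell_{s_i}\leq^L_i\ell_{s_{i-1}}$ for all $1\le i\le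 k$, there exists $\ell\in L$ such that $p^\frown\ell\in P_0$ and $\ell_{s_i}\leq^L_i\ell$ for all $i\le k$. -}

module Defs where

open import Data.Nat using (ℕ; zero; suc; _≤_; _<_)
open import Data.Bool using (Bool; true; false)
open import Data.List using (List; []; _∷ʳ_; length; lookup)
open import Data.List.Relation.Unary.All using (All)
open import Data.Fin using (Fin; toℕ)
open import Data.Product using (Σ; ∃; _×_)
open import Relation.Binary.PropositionalEquality using (_≡_)

-- Computable (decidable) objects are represented by total Agda functions
-- into Bool.  An indexed family of relations (≤_i) is a function
-- R : ℕ → ℕ → ℕ → Bool with  s ≤_i t  iff  R i s t ≡ true; only indices
-- i ≤ n are meaningful.

-- The backbone relations (≤_i)_{i ≤ n} on ω, with (B0)-(B3) and (♣).
-- (B1) uniform computability is built in: rel is a total Agda function.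
record Backbone (n : ℕ) : Set where
  field
    rel     : ℕ → ℕ → ℕ → Bool
    B0→     : ∀ s t → rel 0 s t ≡ true → s ≤ t
    B0←     : ∀ s t → s ≤ t → rel 0 s t ≡ true
    B2-refl  : ∀ i → i ≤ n → ∀ s → rel i s s ≡ true
    B2-trans : ∀ i → i ≤ n → ∀ s t u →
               rel i s t ≡ true → rel i t u ≡ true → rel i s u ≡ true
    B3      : ∀ i j → j ≤ i → i ≤ n → ∀ s t → rel i s t ≡ true → rel j s t ≡ true
    club    : ∀ i → i < n → ∀ r s t → r < s → s < t →
              rel (suc i) r t ≡ true → rel i s t ≡ true → rel (suc i) r s ≡ true

record NSystem (n : ℕ) : Set where
  field
    L      : ℕ → Bool
    P0     : List ℕ → Bool
    lrel   : ℕ → ℕ → ℕ → Bool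
    P0-root   : P0 [] ≡ true
    P0-prefix : ∀ p ℓ → P0 (p ∷ʳ ℓ) ≡ true → P0 p ≡ true
    P0-L      : ∀ p → P0 p ≡ true → All (λ ℓ → L ℓ ≡ true) p
    lrel-refl  : ∀ i → i ≤ n → ∀ ℓ → L ℓ ≡ true → lrel i ℓ ℓ ≡ true
    lrel-trans : ∀ i → i ≤ n → ∀ ℓ ℓ' ℓ'' →
                 L ℓ ≡ true → L ℓ' ≡ true → L ℓ'' ≡ true →
                 lrel i ℓ ℓ' ≡ true → lrel i ℓ' ℓ'' ≡ true → lrel i ℓ ℓ'' ≡ true
    lrel-nested : ∀ i j → j ≤ i → i ≤ n → ∀ ℓ ℓ' →
                  L ℓ ≡ true → L ℓ' ≡ true →
                  lrel i ℓ ℓ' ≡ true → lrel j ℓ ℓ' ≡ true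

module _ {n : ℕ} (B : Backbone n) (S : NSystem n) where
  open Backbone B
  open NSystem S

  IsFinRun : List ℕ → Set
  IsFinRun p = (P0 p ≡ true) ×
    (∀ i → i ≤ n → ∀ (s t : Fin (length p)) →
       rel i (toℕ s) (toℕ t) ≡ true → lrel i (lookup p s) (lookup p t) ≡ true)

  -- The extendibility condition.  A (possibly empty) list of stages
  -- s_k ≤ … ≤ s₀ < s with k ≤ n is given by its length m ≤ n+1 and
  -- σ : Fin m → Fin (length p), σ i = s_i.
  Extendible : Set
  Extendible =
    ∀ (p : List ℕ) → IsFinRun p →
    ∀ (m : ℕ) → m ≤ suc n → (σ : Fin m → Fin (length p)) →
    (∀ (i j : Fin m) → toℕ j ≡ suc (toℕ i) →
        (toℕ (σ j) ≤ toℕ (σ i)) ×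
        (lrel (toℕ j) (lookup p (σ j)) (lookup p (σ i)) ≡ true)) →
    ∃ λ ℓ → (L ℓ ≡ true) × (P0 (p ∷ʳ ℓ) ≡ true) ×
            (∀ (i : Fin m) → lrel (toℕ i) (lookup p (σ i)) ℓ ≡ true)

  prefix : (ℕ → ℕ) → ℕ → List ℕ
  prefix π zero    = []
  prefix π (suc s) = prefix π s ∷ʳ π s

  IsInfRun : (ℕ → ℕ) → Set
  IsInfRun π = (∀ s → P0 (prefix π s) ≡ true) ×
    (∀ i → i ≤ n → ∀ s t → rel i s t ≡ true → lrel i (π s) (π t) ≡ true)

-- At stage s, for every i ≤ n let r_i be the greatest r < s with r ≤_i s, when it
-- exists; by (B3) the i for which it exists form an initial segment i < m.  The
-- condition (♣) makes r_{i+1} ≤ r_i with r_{i+1} ≤_{i+1} r_i, so extendibility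
-- yields a next state ℓ lying ≤^L_i-above every ℓ_{r_i}.  Again by (♣) (and (B0)
-- for i = 0) every a < s with a ≤_i s satisfies a ≤_i r_i, so transitivity puts
-- ℓ above all the states it must dominate, and the run extends forever.
module Submission where

open import Defs
open import Data.Nat using (ℕ; zero; suc; _≤_; _<_; z≤n; s≤s; s≤s⁻¹; s<s⁻¹; _⊔_; _<?_)
open import Data.Nat.Properties
  using (≤-refl; ≤-trans; n≤1+n; m≤n⇒m≤1+n; m<n⇒m<1+n; m≤n⇒m<n∨m≡n; m<1+n⇒m<n∨m≡n;
         <⇒≱; ≮⇒≥; m≤m⊔n; m≤n⊔m)
open import Data.Bool using (Bool; true; false)
open import Data.Bool.Properties using () renaming (_≟_ to _≟ᵇ_)
open import Data.List using (List; []; _∷_; _∷ʳ_; length; lookup; applyUpTo)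
open import Data.List.Properties using (length-applyUpTo; lookup-applyUpTo; applyUpTo-∷ʳ)
open import Data.List.Membership.Propositional.Properties using (∈-lookup)
import Data.List.Relation.Unary.All as All
open import Data.Fin using (Fin; toℕ; fromℕ<)
open import Data.Fin.Properties using (toℕ<n; toℕ-fromℕ<; any?)
open import Data.Product using (Σ; ∃; _×_; _,_; proj₁; proj₂)
open import Data.Sum using (_⊎_; inj₁; inj₂)
open import Relation.Nullary using (Dec; yes; no; ¬_; contradiction)
open import Relation.Nullary.Decidable using (map′)
open import Relation.Binary.PropositionalEquality

module _ (P : ℕ → Bool) where

  Greatest : ℕ → ℕ → Set
  Greatest k r = r < k × P r ≡ true × (∀ r′ → r′ < k → P r′ ≡ true → r′ ≤ r)

  greatest-index : ∀ {k} → ∃ (Greatest k) → Fin k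
  greatest-index (_ , r<k , _) = fromℕ< r<k

  greatest-exists : ∀ {k r} → r < k → P r ≡ true → ∃ (Greatest k)
  greatest-exists {suc k} {r} r<1+k Pr with P k in Pk
  ... | true = k , ≤-refl , Pk , λ _ r′<1+k _ → s≤s⁻¹ r′<1+k
  ... | false with m<1+n⇒m<n∨m≡n r<1+k
  ...   | inj₂ refl = contradiction (trans (sym Pr) Pk) λ ()
  ...   | inj₁ r<k with greatest-exists r<k Pr
  ...     | g , g<k , Pg , below-g = g , m<n⇒m<1+n g<k , Pg , below-g′
    where
    below-g′ : ∀ r′ → r′ < suc k → P r′ ≡ true → r′ ≤ g
    below-g′ r′ r′<1+k Pr′ with m<1+n⇒m<n∨m≡n r′<1+k
    ... | inj₁ r′<k = below-g r′ r′<k Pr′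
    ... | inj₂ refl = contradiction (trans (sym Pr′) Pk) λ ()

  greatest? : ∀ k → Dec (∃ (Greatest k))
  greatest? k = map′
    (λ (x , Px) → greatest-exists (toℕ<n x) Px)
    (λ (r , r<k , Pr , _) → fromℕ< r<k , subst (λ u → P u ≡ true) (sym (toℕ-fromℕ< r<k)) Pr)
    (any? λ x → P (toℕ x) ≟ᵇ true)

longest-prefix : {Q : ℕ → Set} → (∀ j → Dec (Q j)) → ∀ k →
  ∃ λ m → m ≤ k × (∀ j → j < m → Q j) × (m < k → ¬ Q m)
longest-prefix Q? zero = 0 , z≤n , (λ _ ()) , λ ()
longest-prefix {Q} Q? (suc k) with longest-prefix Q? k
... | m , m≤k , all-Q , stop with m <? k
...   | yes m<k = m , m≤n⇒m≤1+n m≤k , all-Q , λ _ → stop m<k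
...   | no m≮k with Q? m
...     | no ¬Qm = m , m≤n⇒m≤1+n m≤k , all-Q , λ _ → ¬Qm
...     | yes Qm = suc m , s≤s m≤k , all-Q′ , λ 1+m<1+k _ → m≮k (s<s⁻¹ 1+m<1+k)
  where
  all-Q′ : ∀ j → j < suc m → Q j
  all-Q′ j j<1+m with m<1+n⇒m<n∨m≡n j<1+m
  ... | inj₁ j<m = all-Q j j<m
  ... | inj₂ refl = Qm

module _ {A : Set} (Good : List A → Set) (good-[] : Good [])
         (extend : ∀ p → Good p → ∃ λ a → Good (p ∷ʳ a)) where

  private
    stage : ℕ → Σ (List A) Good
    stage zero = [] , good-[]
    stage (suc k) with stage k
    ... | p , good-p = p ∷ʳ proj₁ (extend p good-p) , proj₂ (extend p good-p)

  choice-sequence : ℕ → A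
  choice-sequence k = proj₁ (extend (proj₁ (stage k)) (proj₂ (stage k)))

  private
    stage≡applyUpTo : ∀ k → proj₁ (stage k) ≡ applyUpTo choice-sequence k
    stage≡applyUpTo zero = refl
    stage≡applyUpTo (suc k) = trans (cong (_∷ʳ choice-sequence k) (stage≡applyUpTo k))
                                    (applyUpTo-∷ʳ choice-sequence k)

  Good-applyUpTo-choice-sequence : ∀ k → Good (applyUpTo choice-sequence k)
  Good-applyUpTo-choice-sequence k = subst Good (stage≡applyUpTo k) (proj₂ (stage k))

lookup-∷ʳ : ∀ {A : Set} (p : List A) a (x : Fin (length (p ∷ʳ a))) →
  (∃ λ y → toℕ x ≡ toℕ y × lookup (p ∷ʳ a) x ≡ lookup p y) ⊎
  (toℕ x ≡ length p × lookup (p ∷ʳ a) x ≡ a)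
lookup-∷ʳ []      a Fin.zero    = inj₂ (refl , refl)
lookup-∷ʳ (b ∷ p) a Fin.zero    = inj₁ (Fin.zero , refl , refl)
lookup-∷ʳ (b ∷ p) a (Fin.suc x) with lookup-∷ʳ p a x
... | inj₁ (y , x≡y , lookup≡) = inj₁ (Fin.suc y , cong suc x≡y , lookup≡)
... | inj₂ (x≡p , lookup≡)     = inj₂ (cong suc x≡p , lookup≡)

module _ {n : ℕ} (B : Backbone n) where
  open Backbone B

  Parent : ℕ → ℕ → ℕ → Set
  Parent i s = Greatest (λ r → rel i r s) s

  rel⇒≤ : ∀ {i s t} → i ≤ n → rel i s t ≡ true → s ≤ t
  rel⇒≤ {i} i≤n h = B0→ _ _ (B3 i 0 z≤n i≤n _ _ h)

  club-≤ : ∀ {i a r s} → i < n → a ≤ r → r < s →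
           rel (suc i) a s ≡ true → rel i r s ≡ true → rel (suc i) a r ≡ true
  club-≤ {i} i<n a≤r r<s ha hr with m≤n⇒m<n∨m≡n a≤r
  ... | inj₁ a<r  = club i i<n _ _ _ a<r r<s ha hr
  ... | inj₂ refl = B2-refl (suc i) i<n _

  rel-≤ : ∀ {i a r s} → i ≤ n → a ≤ r → r < s →
          rel i a s ≡ true → rel i r s ≡ true → rel i a r ≡ true
  rel-≤ {zero}  _   a≤r _   _  _  = B0← _ _ a≤r
  rel-≤ {suc i} i<n a≤r r<s ha hr = club-≤ i<n a≤r r<s ha (B3 (suc i) i (n≤1+n i) i<n _ _ hr)

  rel-parent : ∀ {i a r s} → i ≤ n → Parent i s r → a < s → rel i a s ≡ true → rel i a r ≡ true
  rel-parent i≤n (r<s , hr , below-r) a<s ha = rel-≤ i≤n (below-r _ a<s ha) r<s ha hr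

  parent-nested : ∀ {i r′ r s} → suc i ≤ n → Parent (suc i) s r′ → Parent i s r →
                  r′ ≤ r × rel (suc i) r′ r ≡ true
  parent-nested {i} {r′} {r} i<n (r′<s , hr′ , _) (r<s , hr , below-r) =
    r′≤r , club-≤ i<n r′≤r r<s hr′ hr
    where
    r′≤r : r′ ≤ r
    r′≤r = below-r _ r′<s (B3 (suc i) i (n≤1+n i) i<n _ _ hr′)

module _ {n : ℕ} (B : Backbone n) (S : NSystem n) where
  open Backbone B
  open NSystem S

  module _ {p : List ℕ} (run : IsFinRun B S p) where

    L-lookup : ∀ a → L (lookup p a) ≡ true
    L-lookup a = All.lookup (P0-L p (proj₁ run)) (∈-lookup a)

    IsFinRun-fromℕ< : ∀ {i a b} → i ≤ n → (a<p : a < length p) (b<p : b < length p) →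
      rel i a b ≡ true → lrel i (lookup p (fromℕ< a<p)) (lookup p (fromℕ< b<p)) ≡ true
    IsFinRun-fromℕ< {i} i≤n a<p b<p h = proj₂ run i i≤n _ _
      (subst₂ (λ u v → rel i u v ≡ true) (sym (toℕ-fromℕ< a<p)) (sym (toℕ-fromℕ< b<p)) h)

    lrel-parents : ∀ {i} → suc i ≤ n →
      (g′ : ∃ (Parent B (suc i) (length p))) (g : ∃ (Parent B i (length p))) →
      toℕ (greatest-index _ g′) ≤ toℕ (greatest-index _ g) ×
      lrel (suc i) (lookup p (greatest-index _ g′)) (lookup p (greatest-index _ g)) ≡ true
    lrel-parents i<n (r′ , par′@(r′<s , _)) (r , par@(r<s , _))
      with parent-nested B i<n par′ par
    ... | r′≤r , rel-r′r =
      subst₂ _≤_ (sym (toℕ-fromℕ< r′<s)) (sym (toℕ-fromℕ< r<s)) r′≤r ,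
      IsFinRun-fromℕ< i<n r′<s r<s rel-r′r

    lrel-below-parent : ∀ {i ℓ} → i ≤ n → L ℓ ≡ true → (g : ∃ (Parent B i (length p))) →
      lrel i (lookup p (greatest-index _ g)) ℓ ≡ true →
      ∀ a → rel i (toℕ a) (length p) ≡ true → lrel i (lookup p a) ℓ ≡ true
    lrel-below-parent {i} i≤n Lℓ (r , par@(r<s , _)) above-r a h =
      lrel-trans i i≤n _ _ _ (L-lookup a) (L-lookup _) Lℓ a≤r above-r
      where
      a≤r : lrel i (lookup p a) (lookup p (fromℕ< r<s)) ≡ true
      a≤r = proj₂ run i i≤n a (fromℕ< r<s)
        (subst (λ u → rel i (toℕ a) u ≡ true) (sym (toℕ-fromℕ< r<s))
               (rel-parent B i≤n par (toℕ<n a) h))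

    IsFinRun-∷ʳ : ∀ {ℓ} → L ℓ ≡ true → P0 (p ∷ʳ ℓ) ≡ true →
      (∀ i → i ≤ n → ∀ a → rel i (toℕ a) (length p) ≡ true → lrel i (lookup p a) ℓ ≡ true) →
      IsFinRun B S (p ∷ʳ ℓ)
    IsFinRun-∷ʳ {ℓ} Lℓ P0ℓ above = P0ℓ , respects
      where
      respects : ∀ i → i ≤ n → ∀ x y → rel i (toℕ x) (toℕ y) ≡ true →
                 lrel i (lookup (p ∷ʳ ℓ) x) (lookup (p ∷ʳ ℓ) y) ≡ true
      respects i i≤n x y h with lookup-∷ʳ p ℓ x | lookup-∷ʳ p ℓ y
      ... | inj₁ (x′ , x≡ , lx) | inj₁ (y′ , y≡ , ly) rewrite lx | ly =
        proj₂ run i i≤n x′ y′ (subst₂ (λ u v → rel i u v ≡ true) x≡ y≡ h)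
      ... | inj₁ (x′ , x≡ , lx) | inj₂ (y≡ , ly) rewrite lx | ly =
        above i i≤n x′ (subst₂ (λ u v → rel i u v ≡ true) x≡ y≡ h)
      ... | inj₂ (x≡ , _) | inj₁ (y′ , y≡ , _) =
        contradiction (rel⇒≤ B i≤n (subst₂ (λ u v → rel i u v ≡ true) x≡ y≡ h)) (<⇒≱ (toℕ<n y′))
      ... | inj₂ (_ , lx) | inj₂ (_ , ly) rewrite lx | ly = lrel-refl i i≤n ℓ Lℓ

  module _ (ext : Extendible B S) {p : List ℕ} (run : IsFinRun B S p) where

    private
      s : ℕ
      s = length p

    parent-indices : ∀ {m} → (∀ j → j < m → ∃ (Parent B j s)) → Fin m → Fin s
    parent-indices parents x = greatest-index _ (parents (toℕ x) (toℕ<n x))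

    parent-indices-chain : ∀ {m} → m ≤ suc n → (parents : ∀ j → j < m → ∃ (Parent B j s)) →
      ∀ (x y : Fin m) → toℕ y ≡ suc (toℕ x) →
      (toℕ (parent-indices parents y) ≤ toℕ (parent-indices parents x)) ×
      (lrel (toℕ y) (lookup p (parent-indices parents y))
                    (lookup p (parent-indices parents x)) ≡ true)
    parent-indices-chain m≤1+n parents x y y≡1+x with toℕ y | toℕ<n y | y≡1+x
    ... | _ | y<m | refl = lrel-parents run (s≤s⁻¹ (≤-trans y<m m≤1+n)) (parents _ y<m) (parents _ _)

    extend-with-parents : ∀ {m} → m ≤ suc n → (parents : ∀ j → j < m → ∃ (Parent B j s)) →
      (m < suc n → ¬ ∃ (Parent B m s)) → ∃ λ ℓ → IsFinRun B S (p ∷ʳ ℓ)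
    extend-with-parents {m} m≤1+n parents no-parent
      with ext p run m m≤1+n (parent-indices parents) (parent-indices-chain m≤1+n parents)
    ... | ℓ , Lℓ , P0ℓ , above-parents = ℓ , IsFinRun-∷ʳ run Lℓ P0ℓ above
      where
      above : ∀ i → i ≤ n → ∀ a → rel i (toℕ a) s ≡ true → lrel i (lookup p a) ℓ ≡ true
      above i i≤n a h with i <? m
      ... | no i≮m = contradiction
        (greatest-exists _ (toℕ<n a) (B3 i m (≮⇒≥ i≮m) i≤n _ _ h))
        (no-parent (s≤s (≤-trans (≮⇒≥ i≮m) i≤n)))
      ... | yes i<m with fromℕ< i<m | toℕ-fromℕ< i<m
      ...   | x | refl =
        lrel-below-parent run i≤n Lℓ (parents (toℕ x) (toℕ<n x)) (above-parents x) a h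

  IsFinRun-extend : Extendible B S → ∀ p → IsFinRun B S p → ∃ λ ℓ → IsFinRun B S (p ∷ʳ ℓ)
  IsFinRun-extend ext p run
    with longest-prefix (λ j → greatest? (λ r → rel j r (length p)) (length p)) (suc n)
  ... | m , m≤1+n , parents , no-parent = extend-with-parents ext run m≤1+n parents no-parent

  prefix≡applyUpTo : ∀ f k → prefix B S f k ≡ applyUpTo f k
  prefix≡applyUpTo f zero    = refl
  prefix≡applyUpTo f (suc k) =
    trans (cong (_∷ʳ f k) (prefix≡applyUpTo f k)) (applyUpTo-∷ʳ f k)

  IsInfRun-applyUpTo : ∀ f → (∀ k → IsFinRun B S (applyUpTo f k)) → IsInfRun B S f
  IsInfRun-applyUpTo f runs =
    (λ k → subst (λ q → P0 q ≡ true) (sym (prefix≡applyUpTo f k)) (proj₁ (runs k))) , respects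
    where
    respects : ∀ i → i ≤ n → ∀ a b → rel i a b ≡ true → lrel i (f a) (f b) ≡ true
    respects i i≤n a b h =
      subst₂ (λ u v → lrel i u v ≡ true) (lookup-at a<k) (lookup-at b<k)
        (IsFinRun-fromℕ< (runs k) i≤n (bound a<k) (bound b<k) h)
      where
      k : ℕ
      k = suc (a ⊔ b)
      a<k : a < k
      a<k = s≤s (m≤m⊔n a b)
      b<k : b < k
      b<k = s≤s (m≤n⊔m a b)
      bound : ∀ {c} → c < k → c < length (applyUpTo f k)
      bound {c} c<k = subst (c <_) (sym (length-applyUpTo f k)) c<k
      lookup-at : ∀ {c} (c<k : c < k) → lookup (applyUpTo f k) (fromℕ< (bound c<k)) ≡ f c
      lookup-at c<k = trans (lookup-applyUpTo f k _) (cong f (toℕ-fromℕ< (bound c<k)))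

theorem2p6 : (n : ℕ) (B : Backbone n) (S : NSystem n) → Extendible B S →
    Σ (ℕ → ℕ) (IsInfRun B S)
theorem2p6 n B S ext = π , IsInfRun-applyUpTo B S π runs
  where
  open NSystem S using (P0-root)
  empty-run : IsFinRun B S []
  empty-run = P0-root , λ _ _ ()
  π : ℕ → ℕ
  π = choice-sequence (IsFinRun B S) empty-run (IsFinRun-extend B S ext)
  runs : ∀ k → IsFinRun B S (applyUpTo π k)
  runs = Good-applyUpTo-choice-sequence (IsFinRun B S) empty-run (IsFinRun-extend B S ext)
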